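{- Let $G=\langle N,E,L,\mathit{root}\rangle$ be an egraph and $\vec v$ a set of variables. The function $r$ returned by $G.\mathit{finddefs}(\vec v)$ (for any order in which elements are removed from $\mathit{todo}$) is an admissible representative function for $G$ and is maximally ground.
   Context: An egraph is $G=\langle N,E,L,\mathit{root}\rangle$ with $\langle N,E\rangle$ a finite DAG with ordered successors ($n[i]$ the $i$-th child, $\deg(n)$ out-degree, leaf = out-degree 0, $\mathit{parents}(n)$ and $\mathit{children}(n)$ as usual), $L$ labelling nodes by function symbols or logical variables, and $\rho_{\mathit{root}}=\{(n,n')\mid\mathit{root}(n)=\mathit{root}(n')\}$ an equivalence relation closed under congruence. $\mathit{class}(n)=\rho_{\mathit{root}}(n)$. $\mathit{ntt}(n)=L(n)$ if $\deg(n)=0$, else $L(n)(\mathit{ntt}(n[1]),\dots,\mathit{ntt}(n[\deg(n)]))$. A term is ground if it contains no variables. $\mathit{finddefs}(\vec v)$: set $r(n):=\star$ (undefined) for all $n$; run $\mathit{process}$ with $\mathit{todo}$ = the set of leaves whose term is ground; then run $\mathit{process}$ with $\mathit{todo}$ = the set of all leaves; return $r$. $\mathit{process}$: while $\mathit{todo}\neq\emptyset$, remove some node $n$; if $r(n)\neq\star$ continue; otherwise set $r(n'):=n$ for all $n'\in\mathit{class}(n)$, and for every $n'\in\mathit{class}(n)$ and every $p\in\mathit{parents}(n')$ such that $r(c)\neq\star$ for all $c\in\mathit{children}(p)$, add $p$ to $\mathit{todo}$. A representative function $r:N\to N$ is admissible for $G$ if (a) $r(n)\in\mathit{class}(n)$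 and $r$ is constant on each class, (b) $\rho_{\mathit{root}}=\{(n,n')\mid r(n)=r(n')\}$, and (c) the graph $G_r=\langle N,E_r\rangle$, $E_r=\{(n,r(c))\mid c\text{ a child of }n\}$, is acyclic. C-groundness (least fixed point): a class is ground if it contains a c-ground node; a node $n$ is c-ground if $\mathit{ntt}(n)$ is ground, or $n$ is not a leaf and the class of every child of $n$ is ground. $r$ is maximally ground if for every $n$, whenever $\mathit{class}(n)$ is ground, $r(n)$ is c-ground. -}

module Defs where

open import Level using (0ℓ)
open import Data.Nat using (ℕ)
open import Data.Fin using (Fin; _≟_)
open import Data.Fin.Subset using (Subset; _∈_; _∉_)
open import Data.List using (List; [])
open import Data.List.Membership.Propositional using () renaming (_∈_ to _∈ₗ_)
open import Data.List.Relation.Unary.All using (All)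
open import Data.List.Relation.Binary.Pointwise using (Pointwise)
open import Data.Maybe using (Maybe; just; nothing; Is-just)
open import Data.Sum using (_⊎_; inj₁; inj₂)
open import Data.Product using (Σ; _×_; _,_)
open import Relation.Binary.PropositionalEquality using (_≡_; _≢_)
open import Relation.Binary.Construct.Closure.Transitive using (TransClosure)
open import Relation.Binary.Construct.Closure.ReflexiveTransitive using (Star)
open import Relation.Nullary using (¬_; does)
open import Data.Bool using (if_then_else_)
open import Function.Bundles using (_⇔_)

Acyclic : {n : ℕ} → (Fin n → Fin n → Set) → Set
Acyclic {n} R = ∀ (x : Fin n) → ¬ TransClosure R x x

-- Nodes are Fin size; children x is the ordered list of successors x[1..deg x];
-- a label is either a function symbol (inj₁) or a variable (inj₂).
record EGraph (Sym Var : Set) : Set where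
  field
    size     : ℕ
    children : Fin size → List (Fin size)
    label    : Fin size → Sym ⊎ Var
    root     : Fin size → Fin size
    acyclic  : Acyclic (λ x y → y ∈ₗ children x)
    congruence : ∀ x y → label x ≡ label y →
                 Pointwise (λ a b → root a ≡ root b) (children x) (children y) →
                 root x ≡ root y

module _ {Sym Var : Set} (G : EGraph Sym Var) where
  open EGraph G

  Node : Set
  Node = Fin size

  SameClass : Node → Node → Set
  SameClass x y = root x ≡ root y

  Leaf : Node → Set
  Leaf x = children x ≡ []

  -- ntt(x) is ground: it contains no variables (written out along the
  -- recursive definition of ntt).
  data NttGround : Node → Set where
    ntt-ground : ∀ {x} (f : Sym) → label x ≡ inj₁ f →
                 All NttGround (children x) → NttGround x

  data CGround : Node → Set where
    cg-ntt  : ∀ {x} → NttGround x → CGround x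
    cg-node : ∀ {x} → ¬ Leaf x →
              All (λ c → Σ Node λ m → SameClass c m × CGround m) (children x) →
              CGround x

  ClassGround : Node → Set
  ClassGround x = Σ Node λ m → SameClass x m × CGround m

  Admissible : (Node → Node) → Set
  Admissible r =
      (∀ x → SameClass x (r x))
    × (∀ x y → SameClass x y → r x ≡ r y)
    × (∀ x y → SameClass x y ⇔ (r x ≡ r y))
    × Acyclic (λ x z → Σ Node λ c → c ∈ₗ children x × z ≡ r c)

  MaximallyGround : (Node → Node) → Set
  MaximallyGround r = ∀ x → ClassGround x → CGround (r x)

  -- ----- the procedure finddefs, as a nondeterministic transition system -----
  -- r(x) = nothing encodes r(x) = ⋆.
  PartialRep : Set
  PartialRep = Node → Maybe Node

  State : Set
  State = PartialRep × Subset size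

  assign : PartialRep → Node → PartialRep
  assign r x y = if does (root y ≟ root x) then just x else r y

  -- one iteration of the while-loop of process, removing node x from todo
  data Step : State → State → Set where
    step-skip : ∀ {r t t'} (x : Node) → x ∈ t → Is-just (r x) →
                (∀ y → y ∈ t' ⇔ (y ∈ t × y ≢ x)) →
                Step (r , t) (r , t')
    step-proc : ∀ {r t t'} (x : Node) → x ∈ t → r x ≡ nothing →
                (∀ y → y ∈ t' ⇔
                   ((y ∈ t × y ≢ x) ⊎
                    (Σ Node λ x' → SameClass x x' × x' ∈ₗ children y
                       × All (λ c → Is-just (assign r x c)) (children y)))) →
                Step (r , t) (assign r x , t')

  ProcessRun : State → PartialRep → Set
  ProcessRun s r' = Σ (Subset size) λ t' → Star Step s (r' , t') × (∀ y → y ∉ t')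

  FindDefs : List Var → PartialRep → Set
  FindDefs vs r =
    Σ (Subset size) λ t₁ → Σ (Subset size) λ t₂ → Σ PartialRep λ r₁ →
        (∀ y → y ∈ t₁ ⇔ (Leaf y × NttGround y))
      × (∀ y → y ∈ t₂ ⇔ Leaf y)
      × ProcessRun ((λ _ → nothing) , t₁) r₁
      × ProcessRun (r₁ , t₂) r

-- Both runs of process maintain an invariant: r is constant on classes and
-- maps each defined node into its own class, every node in todo has all its
-- children defined, and every non-leaf whose children are all defined is
-- either defined or in todo.  Each representative also carries a rank, the
-- time of its assignment, exceeding the ranks of the representatives of its
-- children; so ranks strictly decrease along the edges of G_r,
-- which is therefore acyclic.  Once todo is empty, every node whose children
-- are all defined is itself defined; all leaves were scheduled, so
-- acyclicity of G makes r total.  In the first run only c-ground nodes ever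
-- enter todo, hence every representative chosen there is c-ground, and at
-- its end every node of a ground class is already defined; these choices
-- persist through the second run.
{-# OPTIONS --safe #-}
module Submission where

open import Defs
open import Data.Bool using (if_then_else_)
open import Data.Fin using (Fin; toℕ; _≟_)
open import Data.Fin.Properties using (pigeonhole)
open import Data.Fin.Subset using (Subset; _∈_; _∉_)
open import Data.List using (List; []; _∷_)
open import Data.List.Membership.Propositional using (find) renaming (_∈_ to _∈ₗ_)
open import Data.List.Relation.Unary.All as All using (All; []; _∷_)
open import Data.List.Relation.Unary.All.Properties using (¬All⇒Any¬; ¬Any⇒All¬)
open import Data.List.Relation.Unary.Any using (any?)
open import Data.Maybe using (Maybe; just; nothing; Is-just)
open import Data.Maybe.Properties using (just-injective)
import Data.Maybe.Relation.Unary.Any as Maybe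
open import Data.Nat using (ℕ; zero; suc; _<_; _<′_; ≤′-refl; ≤′-step)
open import Data.Nat.Properties using (<⇒<′; n<1+n; m<n⇒m<1+n; <-trans; <-irrefl)
open import Data.Product using (Σ; ∃; _×_; _,_; proj₁; proj₂)
open import Data.Sum using (_⊎_; inj₁; inj₂)
open import Data.Unit using (tt)
open import Function using (_∘_)
open import Function.Bundles using (_⇔_; mk⇔; Equivalence)
open import Relation.Binary.Construct.Closure.ReflexiveTransitive using (Star; ε; _◅_)
open import Relation.Binary.Construct.Closure.Transitive using (TransClosure; [_]; _∷_; _∷ʳ_)
open import Relation.Binary.PropositionalEquality
open import Relation.Nullary using (¬_; Dec; yes; no; does; contradiction)
open import Relation.Nullary.Decidable using (dec-true; dec-false; toSum)
open import Relation.Unary using (Decidable)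

open Equivalence using (to; from)

is-just⇒≡just : ∀ {A : Set} {m : Maybe A} → Is-just m → ∃ λ a → m ≡ just a
is-just⇒≡just (Maybe.just {a} _) = a , refl

≡just⇒is-just : ∀ {A : Set} {m : Maybe A} {a} → m ≡ just a → Is-just m
≡just⇒is-just refl = Maybe.just tt

sequence-path⁺ : ∀ {A : Set} {_⟶_ : A → A → Set} (f : ℕ → A) →
                 (∀ k → f k ⟶ f (suc k)) →
                 ∀ {i j} → i <′ j → TransClosure _⟶_ (f i) (f j)
sequence-path⁺ f step ≤′-refl        = [ step _ ]
sequence-path⁺ f step (≤′-step i<′j) = sequence-path⁺ f step i<′j ∷ʳ step _

acyclic⇒no-infinite-walk : ∀ {n} {_⟶_ : Fin n → Fin n → Set} → Acyclic _⟶_ →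
                           (f : ℕ → Fin n) → ¬ (∀ k → f k ⟶ f (suc k))
acyclic⇒no-infinite-walk {n} acyclic f step
  with i , j , i<j , fi≡fj ← pigeonhole (n<1+n n) (f ∘ toℕ)
  = acyclic (f (toℕ i))
      (subst (TransClosure _ (f (toℕ i))) (sym fi≡fj) (sequence-path⁺ f step (<⇒<′ i<j)))

acyclic-induction : ∀ {n} (succ : Fin n → List (Fin n)) →
                    Acyclic (λ x y → y ∈ₗ succ x) →
                    {P : Fin n → Set} → Decidable P →
                    (∀ x → All P (succ x) → P x) → ∀ x → P x
acyclic-induction succ acyclic {P} P? closed x with P? x
... | yes px = px
... | no ¬px = contradiction (λ k → proj₁ (proj₂ (escape (proj₂ (walk k)))))
                 (acyclic⇒no-infinite-walk acyclic (proj₁ ∘ walk))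
  where
  escape : ∀ {y} → ¬ P y → ∃ λ z → z ∈ₗ succ y × ¬ P z
  escape {y} ¬py = find (¬All⇒Any¬ P? (succ y) (¬py ∘ closed y))

  walk : ℕ → ∃ λ y → ¬ P y
  walk zero    = x , ¬px
  walk (suc k) = proj₁ (escape (proj₂ (walk k))) , proj₂ (proj₂ (escape (proj₂ (walk k))))

module FindDefs {Sym Var : Set} (G : EGraph Sym Var) where
  open EGraph G

  Defined : PartialRep G → Node G → Set
  Defined r x = Is-just (r x)

  Ready : PartialRep G → Node G → Set
  Ready r x = All (Defined r) (children x)

  IsRep : PartialRep G → Node G → Set
  IsRep r z = r z ≡ just z

  Handled : PartialRep G → Subset size → Node G → Set
  Handled r t x = Defined r x ⊎ x ∈ t

  Empty : Subset size → Set
  Empty t = ∀ y → y ∉ t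

  _⊑_ : PartialRep G → PartialRep G → Set
  r ⊑ r' = ∀ {y a} → r y ≡ just a → r' y ≡ just a

  handled⇒defined : ∀ {r t y} → Empty t → Handled r t y → Defined r y
  handled⇒defined empty (inj₁ d)   = d
  handled⇒defined empty (inj₂ y∈t) = contradiction y∈t (empty _)

  same-class? : ∀ x y → Dec (SameClass G x y)
  same-class? x y = root x ≟ root y

  leaf? : ∀ x → Dec (Leaf G x)
  leaf? x with children x
  ... | []    = yes refl
  ... | _ ∷ _ = no λ ()

  parent⇒non-leaf : ∀ {c y} → c ∈ₗ children y → ¬ Leaf G y
  parent⇒non-leaf c∈ leaf = contradiction (subst (_ ∈ₗ_) leaf c∈) λ ()

  assign-inside : ∀ r {x y} → SameClass G y x → assign G r x y ≡ just x
  assign-inside r {x} {y} y~x =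
    cong (λ b → if b then just x else r y) (dec-true (same-class? y x) y~x)

  assign-outside : ∀ r {x y} → ¬ SameClass G y x → assign G r x y ≡ r y
  assign-outside r {x} {y} y≁x =
    cong (λ b → if b then just x else r y) (dec-false (same-class? y x) y≁x)

  record Invariant (r : PartialRep G) (t : Subset size) : Set where
    field
      class-constant : ∀ x y → SameClass G x y → r x ≡ r y
      value-in-class : ∀ x z → r x ≡ just z → SameClass G x z
      todo-ready     : ∀ y → y ∈ t → Ready r y
      ready-handled  : ∀ y → ¬ Leaf G y → Ready r y → Handled r t y
      rank           : Node G → ℕ
      rank-bound     : ℕ
      rank<bound     : ∀ z → IsRep r z → rank z < rank-bound
      rank-descends  : ∀ z → IsRep r z →
                       All (λ c → ∃ λ w → r c ≡ just w × rank w < rank z) (children z)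

    value-is-rep : ∀ {c w} → r c ≡ just w → IsRep r w
    value-is-rep {c} {w} rc≡w = trans (sym (class-constant c w (value-in-class c w rc≡w))) rc≡w

  record GroundInvariant (r : PartialRep G) (t : Subset size) : Set where
    field
      reps-ground : ∀ z → IsRep r z → CGround G z
      todo-ground : ∀ y → y ∈ t → CGround G y

  module Processing {r t t'} (inv : Invariant r t) (x : Node G) (x∈t : x ∈ t)
    (rx≡nothing : r x ≡ nothing)
    (t'-spec : ∀ y → y ∈ t' ⇔ ((y ∈ t × y ≢ x) ⊎
                 (Σ (Node G) λ x' → SameClass G x x' × x' ∈ₗ children y
                    × Ready (assign G r x) y))) where
    open Invariant inv

    r' : PartialRep G
    r' = assign G r x

    defined⇒other-class : ∀ {y a} → r y ≡ just a → ¬ SameClass G y x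
    defined⇒other-class {y} ry≡a y~x =
      contradiction (trans (sym ry≡a) (trans (class-constant y x y~x) rx≡nothing)) λ ()

    rep≢x : ∀ {z} → IsRep r z → z ≢ x
    rep≢x rz≡z refl = contradiction (trans (sym rz≡z) rx≡nothing) λ ()

    extends : r ⊑ r'
    extends ry≡a = trans (assign-outside r (defined⇒other-class ry≡a)) ry≡a

    extends-defined : ∀ {y} → Defined r y → Defined r' y
    extends-defined d = ≡just⇒is-just (extends (proj₂ (is-just⇒≡just d)))

    old-rep : ∀ {z} → IsRep r' z → z ≢ x → IsRep r z
    old-rep {z} r'z≡z z≢x with toSum (same-class? z x)
    ... | inj₁ z~x = contradiction (just-injective (trans (sym (assign-inside r z~x)) r'z≡z)) (z≢x ∘ sym)
    ... | inj₂ z≁x = trans (sym (assign-outside r z≁x)) r'z≡z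

    class-constant' : ∀ y z → SameClass G y z → r' y ≡ r' z
    class-constant' y z y~z with toSum (same-class? y x)
    ... | inj₁ y~x = trans (assign-inside r y~x) (sym (assign-inside r (trans (sym y~z) y~x)))
    ... | inj₂ y≁x = begin
      r' y ≡⟨ assign-outside r y≁x ⟩
      r y  ≡⟨ class-constant y z y~z ⟩
      r z  ≡⟨ assign-outside r (y≁x ∘ trans y~z) ⟨
      r' z ∎
      where open ≡-Reasoning

    value-in-class' : ∀ y z → r' y ≡ just z → SameClass G y z
    value-in-class' y z r'y≡z with toSum (same-class? y x)
    ... | inj₁ y~x = trans y~x (cong root (just-injective (trans (sym (assign-inside r y~x)) r'y≡z)))
    ... | inj₂ y≁x = value-in-class y z (trans (sym (assign-outside r y≁x)) r'y≡z)

    todo-ready' : ∀ y → y ∈ t' → Ready r' y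
    todo-ready' y y∈t' with to (t'-spec y) y∈t'
    ... | inj₁ (y∈t , _)          = All.map extends-defined (todo-ready y y∈t)
    ... | inj₂ (_ , _ , _ , ready) = ready

    handled' : ∀ {y} → Handled r t y → Handled r' t' y
    handled' (inj₁ d) = inj₁ (extends-defined d)
    handled' {y} (inj₂ y∈t) with toSum (y ≟ x)
    ... | inj₁ refl = inj₁ (≡just⇒is-just (assign-inside r refl))
    ... | inj₂ y≢x = inj₂ (from (t'-spec y) (inj₁ (y∈t , y≢x)))

    -- A ready parent of the class of x is scheduled; any other ready node was
    -- already ready before the step, as assign only touched the class of x.
    ready-handled' : ∀ y → ¬ Leaf G y → Ready r' y → Handled r' t' y
    ready-handled' y non-leaf ready with any? (λ c → same-class? c x) (children y)
    ... | yes child~x = let c , c∈ , c~x = find child~x in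
                        inj₂ (from (t'-spec y) (inj₂ (c , sym c~x , c∈ , ready)))
    ... | no ¬child~x = handled' (ready-handled y non-leaf
                          (All.zipWith (λ (c≁x , d) → subst Is-just (assign-outside r c≁x) d)
                                       (¬Any⇒All¬ (children y) ¬child~x , ready)))

    rank' : Node G → ℕ
    rank' y = if does (y ≟ x) then rank-bound else rank y

    rank'-x : rank' x ≡ rank-bound
    rank'-x = cong (λ b → if b then rank-bound else rank x) (dec-true (x ≟ x) refl)

    rank'-other : ∀ {y} → y ≢ x → rank' y ≡ rank y
    rank'-other {y} y≢x = cong (λ b → if b then rank-bound else rank y) (dec-false (y ≟ x) y≢x)

    rank<bound' : ∀ z → IsRep r' z → rank' z < suc rank-bound
    rank<bound' z r'z≡z with toSum (z ≟ x)
    ... | inj₁ refl = subst (_< suc rank-bound) (sym rank'-x) (n<1+n rank-bound)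
    ... | inj₂ z≢x = subst (_< suc rank-bound) (sym (rank'-other z≢x))
                       (m<n⇒m<1+n (rank<bound z (old-rep r'z≡z z≢x)))

    rank-descends' : ∀ z → IsRep r' z →
                     All (λ c → ∃ λ w → r' c ≡ just w × rank' w < rank' z) (children z)
    rank-descends' z r'z≡z with toSum (z ≟ x)
    ... | inj₁ refl = All.map descend (todo-ready x x∈t)
      where
      descend : ∀ {c} → Defined r c → ∃ λ w → r' c ≡ just w × rank' w < rank' x
      descend d with w , rc≡w ← is-just⇒≡just d =
        w , extends rc≡w ,
        subst₂ _<_ (sym (rank'-other (rep≢x (value-is-rep rc≡w)))) (sym rank'-x)
               (rank<bound w (value-is-rep rc≡w))
    ... | inj₂ z≢x = All.map descend (rank-descends z (old-rep r'z≡z z≢x))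
      where
      descend : ∀ {c} → (∃ λ w → r c ≡ just w × rank w < rank z) →
                ∃ λ w → r' c ≡ just w × rank' w < rank' z
      descend (w , rc≡w , w<z) =
        w , extends rc≡w ,
        subst₂ _<_ (sym (rank'-other (rep≢x (value-is-rep rc≡w)))) (sym (rank'-other z≢x)) w<z

    invariant : Invariant r' t'
    invariant = record
      { class-constant = class-constant'
      ; value-in-class = value-in-class'
      ; todo-ready     = todo-ready'
      ; ready-handled  = ready-handled'
      ; rank           = rank'
      ; rank-bound     = suc rank-bound
      ; rank<bound     = rank<bound'
      ; rank-descends  = rank-descends'
      }

    ground : GroundInvariant r t → GroundInvariant r' t'
    ground gi = record { reps-ground = reps-ground' ; todo-ground = todo-ground' }
      where
      open GroundInvariant gi
      reps-ground' : ∀ z → IsRep r' z → CGround G z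
      reps-ground' z r'z≡z with toSum (z ≟ x)
      ... | inj₁ refl = todo-ground x x∈t
      ... | inj₂ z≢x = reps-ground z (old-rep r'z≡z z≢x)

      todo-ground' : ∀ y → y ∈ t' → CGround G y
      todo-ground' y y∈t' with to (t'-spec y) y∈t'
      ... | inj₁ (y∈t , _) = todo-ground y y∈t
      ... | inj₂ (_ , _ , x'∈ , ready) = cg-node (parent⇒non-leaf x'∈) (All.map ground-class ready)
        where
        ground-class : ∀ {c} → Defined r' c → ClassGround G c
        ground-class {c} d with w , r'c≡w ← is-just⇒≡just d =
          w , value-in-class' c w r'c≡w ,
          reps-ground' w (Invariant.value-is-rep invariant r'c≡w)

  step-handled : ∀ {r t r' t'} → Invariant r t → Step G (r , t) (r' , t') →
                 ∀ {y} → Handled r t y → Handled r' t' y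
  step-handled inv (step-skip x x∈t dx t'-spec) (inj₁ d) = inj₁ d
  step-handled inv (step-skip x x∈t dx t'-spec) {y} (inj₂ y∈t) with toSum (y ≟ x)
  ... | inj₁ refl = inj₁ dx
  ... | inj₂ y≢x = inj₂ (from (t'-spec y) (y∈t , y≢x))
  step-handled inv (step-proc x x∈t rx t'-spec) = Processing.handled' inv x x∈t rx t'-spec

  step-invariant : ∀ {r t r' t'} → Invariant r t → Step G (r , t) (r' , t') → Invariant r' t'
  step-invariant inv st@(step-skip x x∈t dx t'-spec) = record
    { class-constant = class-constant
    ; value-in-class = value-in-class
    ; todo-ready     = λ y y∈t' → todo-ready y (proj₁ (to (t'-spec y) y∈t'))
    ; ready-handled  = λ y non-leaf ready → step-handled inv st (ready-handled y non-leaf ready)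
    ; rank           = rank
    ; rank-bound     = rank-bound
    ; rank<bound     = rank<bound
    ; rank-descends  = rank-descends
    }
    where open Invariant inv
  step-invariant inv (step-proc x x∈t rx t'-spec) = Processing.invariant inv x x∈t rx t'-spec

  step-extends : ∀ {r t r' t'} → Invariant r t → Step G (r , t) (r' , t') → r ⊑ r'
  step-extends inv (step-skip x x∈t dx t'-spec) ry≡a = ry≡a
  step-extends inv (step-proc x x∈t rx t'-spec) = Processing.extends inv x x∈t rx t'-spec

  step-ground : ∀ {r t r' t'} → Invariant r t → GroundInvariant r t →
                Step G (r , t) (r' , t') → GroundInvariant r' t'
  step-ground inv gi (step-skip x x∈t dx t'-spec) = record
    { reps-ground = reps-ground
    ; todo-ground = λ y y∈t' → todo-ground y (proj₁ (to (t'-spec y) y∈t'))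
    }
    where open GroundInvariant gi
  step-ground inv gi (step-proc x x∈t rx t'-spec) = Processing.ground inv x x∈t rx t'-spec gi

  run-invariant : ∀ {r t r' t'} → Invariant r t → Star (Step G) (r , t) (r' , t') → Invariant r' t'
  run-invariant inv ε          = inv
  run-invariant inv (st ◅ run) = run-invariant (step-invariant inv st) run

  run-extends : ∀ {r t r' t'} → Invariant r t → Star (Step G) (r , t) (r' , t') → r ⊑ r'
  run-extends inv ε          ry≡a = ry≡a
  run-extends inv (st ◅ run) ry≡a = run-extends (step-invariant inv st) run (step-extends inv st ry≡a)

  run-handled : ∀ {r t r' t'} → Invariant r t → Star (Step G) (r , t) (r' , t') →
                ∀ {y} → Handled r t y → Handled r' t' y
  run-handled inv ε          h = h
  run-handled inv (st ◅ run) h = run-handled (step-invariant inv st) run (step-handled inv st h)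

  run-ground : ∀ {r t r' t'} → Invariant r t → GroundInvariant r t →
               Star (Step G) (r , t) (r' , t') → GroundInvariant r' t'
  run-ground inv gi ε          = gi
  run-ground inv gi (st ◅ run) = run-ground (step-invariant inv st) (step-ground inv gi st) run

  leaf⇒ready : ∀ {r y} → Leaf G y → Ready r y
  leaf⇒ready leaf = subst (All _) (sym leaf) []

  non-leaf⇒¬ready-initially : ∀ {y} → ¬ Leaf G y → ¬ Ready (λ _ → nothing) y
  non-leaf⇒¬ready-initially {y} non-leaf ready with children y
  ... | []    = non-leaf refl
  ... | _ ∷ _ with () ∷ _ ← ready

  initial : ∀ {t} → (∀ y → y ∈ t → Leaf G y) → Invariant (λ _ → nothing) t
  initial leaves = record
    { class-constant = λ _ _ _ → refl
    ; value-in-class = λ _ _ ()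
    ; todo-ready     = λ y y∈t → leaf⇒ready (leaves y y∈t)
    ; ready-handled  = λ y non-leaf ready → contradiction ready (non-leaf⇒¬ready-initially non-leaf)
    ; rank           = λ _ → 0
    ; rank-bound     = 0
    ; rank<bound     = λ _ ()
    ; rank-descends  = λ _ ()
    }

  initial-ground : ∀ {t} → (∀ y → y ∈ t → NttGround G y) → GroundInvariant (λ _ → nothing) t
  initial-ground ground = record
    { reps-ground = λ _ ()
    ; todo-ground = λ y y∈t → cg-ntt (ground y y∈t)
    }

  module Finished {r t} (inv : Invariant r t) (empty : Empty t) where
    open Invariant inv

    ready⇒defined : ∀ y → ¬ Leaf G y → Ready r y → Defined r y
    ready⇒defined y non-leaf ready = handled⇒defined {r} empty (ready-handled y non-leaf ready)

    restart : ∀ {t'} → (∀ y → y ∈ t' → Leaf G y) → Invariant r t'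
    restart leaves = record
      { class-constant = class-constant
      ; value-in-class = value-in-class
      ; todo-ready     = λ y y∈t' → leaf⇒ready (leaves y y∈t')
      ; ready-handled  = λ y non-leaf ready → inj₁ (ready⇒defined y non-leaf ready)
      ; rank           = rank
      ; rank-bound     = rank-bound
      ; rank<bound     = rank<bound
      ; rank-descends  = rank-descends
      }

    everywhere-defined : (∀ y → Leaf G y → Defined r y) → ∀ y → Defined r y
    everywhere-defined leaves-defined =
      acyclic-induction children acyclic (λ y → Maybe.dec (λ _ → yes tt) (r y)) closed
      where
      closed : ∀ y → Ready r y → Defined r y
      closed y ready with leaf? y
      ... | yes leaf    = leaves-defined y leaf
      ... | no non-leaf = ready⇒defined y non-leaf ready

    module _ (ground-leaves-defined : ∀ y → Leaf G y → NttGround G y → Defined r y) where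
      ntt-ground⇒defined : ∀ {y} → NttGround G y → Defined r y
      all-ntt-ground⇒defined : ∀ {ys} → All (NttGround G) ys → All (Defined r) ys

      ntt-ground⇒defined {y} ntt@(ntt-ground _ _ children-ground) with leaf? y
      ... | yes leaf    = ground-leaves-defined y leaf ntt
      ... | no non-leaf = ready⇒defined y non-leaf (all-ntt-ground⇒defined children-ground)

      all-ntt-ground⇒defined []       = []
      all-ntt-ground⇒defined (g ∷ gs) = ntt-ground⇒defined g ∷ all-ntt-ground⇒defined gs

      c-ground⇒defined : ∀ {y} → CGround G y → Defined r y
      class-ground⇒defined : ∀ {y} → ClassGround G y → Defined r y
      all-class-ground⇒defined : ∀ {ys} → All (ClassGround G) ys → All (Defined r) ys

      c-ground⇒defined (cg-ntt ntt) = ntt-ground⇒defined ntt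
      c-ground⇒defined {y} (cg-node non-leaf children-ground) =
        ready⇒defined y non-leaf (all-class-ground⇒defined children-ground)

      class-ground⇒defined {y} (m , y~m , m-ground) =
        subst Is-just (sym (class-constant y m y~m)) (c-ground⇒defined m-ground)

      all-class-ground⇒defined []       = []
      all-class-ground⇒defined (g ∷ gs) = class-ground⇒defined g ∷ all-class-ground⇒defined gs

  module Representatives {r t} (inv : Invariant r t) (r' : Node G → Node G)
                         (r≡r' : ∀ x → r x ≡ just (r' x)) where
    open Invariant inv

    in-class : ∀ x → SameClass G x (r' x)
    in-class x = value-in-class x (r' x) (r≡r' x)

    constant : ∀ x y → SameClass G x y → r' x ≡ r' y
    constant x y x~y = just-injective (trans (sym (r≡r' x)) (trans (class-constant x y x~y) (r≡r' y)))

    separating : ∀ x y → r' x ≡ r' y → SameClass G x y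
    separating x y r'x≡r'y = trans (in-class x) (trans (cong root r'x≡r'y) (sym (in-class y)))

    _⟶_ : Node G → Node G → Set
    x ⟶ z = Σ (Node G) λ c → c ∈ₗ children x × z ≡ r' c

    target-is-rep : ∀ {x z} → x ⟶ z → IsRep r z
    target-is-rep (c , _ , refl) = value-is-rep (r≡r' c)

    target-is-rep⁺ : ∀ {x z} → TransClosure _⟶_ x z → IsRep r z
    target-is-rep⁺ [ e ]    = target-is-rep e
    target-is-rep⁺ (_ ∷ es) = target-is-rep⁺ es

    rank-decreases : ∀ {x z} → IsRep r x → x ⟶ z → rank z < rank x
    rank-decreases {x} rx≡x (c , c∈ , refl)
      with w , rc≡w , w<x ← All.lookup (rank-descends x rx≡x) c∈ =
      subst (λ w → rank w < rank x) (just-injective (trans (sym rc≡w) (r≡r' c))) w<x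

    rank-decreases⁺ : ∀ {x z} → IsRep r x → TransClosure _⟶_ x z → rank z < rank x
    rank-decreases⁺ rx≡x [ e ]    = rank-decreases rx≡x e
    rank-decreases⁺ rx≡x (e ∷ es) = <-trans (rank-decreases⁺ (target-is-rep e) es) (rank-decreases rx≡x e)

    admissible : Admissible G r'
    admissible = in-class , constant , (λ x y → mk⇔ (constant x y) (separating x y)) ,
                 λ x cycle → <-irrefl refl (rank-decreases⁺ (target-is-rep⁺ cycle) cycle)

  maximally-ground : ∀ {r₁ t₁ r} {r' : Node G → Node G} →
                     Invariant r₁ t₁ → GroundInvariant r₁ t₁ →
                     (∀ {y} → ClassGround G y → Defined r₁ y) → r₁ ⊑ r →
                     (∀ x → r x ≡ just (r' x)) → MaximallyGround G r'
  maximally-ground {r = r} {r'} inv gi class-ground⇒defined r₁⊑r r≡r' x x-ground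
    with a , r₁x≡a ← is-just⇒≡just (class-ground⇒defined x-ground) =
    subst (CGround G) (just-injective (trans (sym (r₁⊑r r₁x≡a)) (r≡r' x)))
          (reps-ground a (value-is-rep r₁x≡a))
    where
    open Invariant inv
    open GroundInvariant gi

lemma13 : {Sym Var : Set} (G : EGraph Sym Var) (vs : List Var)
          (r : Fin (EGraph.size G) → Maybe (Fin (EGraph.size G))) →
          FindDefs G vs r →
          Σ (Fin (EGraph.size G) → Fin (EGraph.size G)) λ r' →
            (∀ x → r x ≡ just (r' x)) × Admissible G r' × MaximallyGround G r'
lemma13 G vs r (t₁ , t₂ , r₁ , t₁-spec , t₂-spec , (u₁ , run₁ , done₁) , (u₂ , run₂ , done₂)) =
  r' , r≡r' , Representatives.admissible inv₂ r' r≡r' ,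
  maximally-ground inv₁ ground₁ (Finished.class-ground⇒defined inv₁ done₁ ground-leaves-defined)
                   (run-extends inv₁' run₂) r≡r'
  where
  open FindDefs G

  inv₀ : Invariant (λ _ → nothing) t₁
  inv₀ = initial (λ y → proj₁ ∘ to (t₁-spec y))
  inv₁ : Invariant r₁ u₁
  inv₁ = run-invariant inv₀ run₁

  ground₁ : GroundInvariant r₁ u₁
  ground₁ = run-ground inv₀ (initial-ground (λ y → proj₂ ∘ to (t₁-spec y))) run₁

  ground-leaves-defined : ∀ y → Leaf G y → NttGround G y → Defined r₁ y
  ground-leaves-defined y leaf ntt =
    handled⇒defined {r₁} done₁ (run-handled inv₀ run₁ (inj₂ (from (t₁-spec y) (leaf , ntt))))

  inv₁' : Invariant r₁ t₂
  inv₁' = Finished.restart inv₁ done₁ (λ y → to (t₂-spec y))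
  inv₂ : Invariant r u₂
  inv₂ = run-invariant inv₁' run₂

  leaves-defined : ∀ y → Leaf G y → Defined r y
  leaves-defined y leaf = handled⇒defined {r} done₂ (run-handled inv₁' run₂ (inj₂ (from (t₂-spec y) leaf)))

  total : ∀ x → Defined r x
  total = Finished.everywhere-defined inv₂ done₂ leaves-defined

  r' : Node G → Node G
  r' x = proj₁ (is-just⇒≡just (total x))

  r≡r' : ∀ x → r x ≡ just (r' x)
  r≡r' x = proj₂ (is-just⇒≡just (total x))
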